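{- Let $\pi,\sigma\in S_n$ and $0\leq m\leq n$, and suppose that $\sigma^\circ=m+\pi^\circ$ (as circular permutations). Then $\overline{\sigma}=\gamma^m\circ\overline{\pi}\circ\gamma^{ -m}$, where $\gamma=(0,1,2,\ldots,n)$.
   Context: Permutations are composed right to left; $\pi\in S_n$ is written $\langle \pi_1\ \cdots\ \pi_n\rangle$, $\pi_i=\pi(i)$, and identified with the permutation of $\{0,\ldots,n\}$ fixing $0$. For $\pi\in S_n$, $\overline{\pi}=(0,1,2,\ldots,n)\circ(0,\pi_n,\pi_{n-1},\ldots,\pi_1)$, a permutation of $\{0,\ldots,n\}$. The circular permutation of $\pi$ is $\pi^\circ=0\ \pi_1\ \pi_2\ \cdots\ \pi_n$, a cyclic sequence (considered up to rotation). For $0\leq m\leq n$, $m+\pi^\circ$ is the cyclic sequence $\overline{0}^m\ \overline{\pi_1}^m\ \cdots\ \overline{\pi_n}^m$ where $\overline{x}^m=(x+m)\bmod (n+1)$. A cyclic sequence containing each of $0,\ldots,n$ once determines a permutation of $S_n$ by reading, in cyclic order, the $n$ entries following $0$; "$\sigma^\circ=m+\pi^\circ$" means $\sigma$ is the permutation so determined by $m+\pi^\circ$. -}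

module Defs where

open import Data.Nat using (ℕ; zero; suc; _+_; _≤_)
open import Data.Nat.DivMod using (_mod_)
open import Data.Fin using (Fin; toℕ; _≟_)
import Data.Fin as F
open import Data.Fin.Permutation using (Permutation′; _⟨$⟩ʳ_)
open import Data.List using (List; []; _∷_; map; reverse; drop; take; _++_; length)
open import Data.List.Base using ()
open import Data.Product using (∃; _×_)
open import Relation.Binary.PropositionalEquality using (_≡_)
open import Relation.Nullary using (yes; no)
open import Function using (_∘_)

-- Elements of {0,…,n} are Fin (suc n).  A permutation π ∈ S_n is a
-- Permutation′ n of Fin n; its value π_i (i ∈ {1..n}) is
-- suc (π ⟨$⟩ʳ (i-1)), viewed in {0..n} (so π fixes 0).

shift : (n m : ℕ) → Fin (suc n) → Fin (suc n)
shift n m x = (toℕ x + m) mod (suc n)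

γ : (n : ℕ) → Fin (suc n) → Fin (suc n)
γ n = shift n 1

γ⁻¹ : (n : ℕ) → Fin (suc n) → Fin (suc n)
γ⁻¹ n = shift n n

iter : {A : Set} → ℕ → (A → A) → A → A
iter zero f = λ x → x
iter (suc k) f = f ∘ iter k f

-- The cycle (a₀, a₁, …, a_k) given as a list of distinct elements:
-- a_i ↦ a_{i+1}, a_k ↦ a₀, everything else fixed.
cycleGo : {N : ℕ} → Fin N → Fin N → List (Fin N) → Fin N → Fin N
-- cycleGo first y rest x : current element y, followed by rest
cycleGo first y [] x with x ≟ y
... | yes _ = first
... | no _ = x
cycleGo first y (z ∷ r) x with x ≟ y
... | yes _ = z
... | no _ = cycleGo first z r x

cycle : {N : ℕ} → List (Fin N) → Fin N → Fin N
cycle [] x = x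
cycle (a ∷ as) x = cycleGo a a as x

entries : {n : ℕ} → Permutation′ n → List (Fin (suc n))
entries {n} π = map (λ i → F.suc (π ⟨$⟩ʳ i)) (Data.List.allFin n)
  where import Data.List

bar : {n : ℕ} → Permutation′ n → Fin (suc n) → Fin (suc n)
bar {n} π = γ n ∘ cycle (F.zero ∷ reverse (entries π))

-- circular permutation π° = 0 π₁ ⋯ πₙ (a representative list)
circ : {n : ℕ} → Permutation′ n → List (Fin (suc n))
circ π = F.zero ∷ entries π

shiftCirc : {n : ℕ} → ℕ → Permutation′ n → List (Fin (suc n))
shiftCirc {n} m π = map (shift n m) (circ π)

rotate : {A : Set} → ℕ → List A → List A
rotate k xs = drop k xs ++ take k xs

_≈∘_ : {A : Set} → List A → List A → Set
xs ≈∘ ys = ∃ λ k → rotate k xs ≡ ys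

-- The cycle (0, πₙ, …, π₁) in π̄ is the cycle of the reversed sequence π°,
-- and the cycle of a list of distinct elements only depends on the list up
-- to rotation.  So σ° = m + π° makes the cycle of σ the image of the cycle
-- of π under x ↦ x + m = γᵐ, i.e. its conjugate by γᵐ; and γ commutes
-- with γᵐ.
module Submission where

open import Defs
open import Data.Nat using (ℕ; zero; suc; _+_; _≤_; _%_)
open import Data.Nat.Properties using (+-comm; +-assoc)
open import Data.Nat.DivMod using (%-distribˡ-+; m%n%n≡m%n; [m+n]%n≡m%n; m<n⇒m%n≡m)
open import Data.Fin using (Fin; zero; suc; toℕ; _≟_)
open import Data.Fin.Properties using (toℕ-injective; toℕ-fromℕ<; toℕ<n; suc-injective)
open import Data.Fin.Permutation using (Permutation′; _⟨$⟩ʳ_)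
open import Data.List using (List; []; _∷_; [_]; _++_; _∷ʳ_; map; reverse; take; drop; allFin)
open import Data.List.Properties using (++-identityʳ; ++-assoc; reverse-++; reverse-map; unfold-reverse; take++drop≡id; map-∘)
open import Data.List.Membership.Propositional using (_∉_)
open import Data.List.Membership.Propositional.Properties using (∈-map⁻)
open import Data.List.Relation.Unary.All using ([])
open import Data.List.Relation.Unary.All.Properties using (¬Any⇒All¬)
open import Data.List.Relation.Unary.Any using (here; there)
open import Data.List.Relation.Unary.Any.Properties using (reverse⁻)
open import Data.List.Relation.Unary.Unique.Propositional using (Unique; []; _∷_)
open import Data.List.Relation.Unary.Unique.Propositional.Properties using (++⁺; map⁺; allFin⁺; Unique[x∷xs]⇒x∉xs)
open import Data.List.Relation.Binary.Permutation.Setoid using (↭-sym)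
open import Data.List.Relation.Binary.Permutation.Setoid.Properties using (Unique-resp-↭; ↭-reverse)
open import Data.Product using (_,_)
open import Data.Empty using (⊥-elim)
open import Function using (_∘_)
open import Function.Bundles using (Injection)
open import Function.Properties.Inverse using (↔⇒↣)
open import Relation.Binary.PropositionalEquality using (_≡_; _≢_; refl; sym; trans; cong; subst; setoid; module ≡-Reasoning)
open import Relation.Nullary using (yes; no)

module _ {N : ℕ} where

  cycleGo-∷ʳ-last : (f y : Fin N) (r : List (Fin N)) (z : Fin N) →
                    z ∉ y ∷ r → cycleGo f y (r ∷ʳ z) z ≡ f
  cycleGo-∷ʳ-last f y [] z z∉ with z ≟ y
  ... | yes z≡y = ⊥-elim (z∉ (here z≡y))
  ... | no _ with z ≟ z
  ...   | yes _ = refl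
  ...   | no z≢z = ⊥-elim (z≢z refl)
  cycleGo-∷ʳ-last f y (w ∷ r) z z∉ with z ≟ y
  ... | yes z≡y = ⊥-elim (z∉ (here z≡y))
  ... | no _ = cycleGo-∷ʳ-last f w r z (z∉ ∘ there)

  cycleGo-∷ʳ : (f y : Fin N) (r : List (Fin N)) (z x : Fin N) →
               x ≢ z → cycleGo f y (r ∷ʳ z) x ≡ cycleGo z y r x
  cycleGo-∷ʳ f y [] z x x≢z with x ≟ y
  ... | yes _ = refl
  ... | no _ with x ≟ z
  ...   | yes x≡z = ⊥-elim (x≢z x≡z)
  ...   | no _ = refl
  cycleGo-∷ʳ f y (w ∷ r) z x x≢z with x ≟ y
  ... | yes _ = refl
  ... | no _ = cycleGo-∷ʳ f w r z x x≢z

  cycle-∷≡∷ʳ : (a : Fin N) (as : List (Fin N)) (x : Fin N) →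
               a ∉ as → cycle (a ∷ as) x ≡ cycle (as ∷ʳ a) x
  cycle-∷≡∷ʳ a [] x a∉ = refl
  cycle-∷≡∷ʳ a (b ∷ bs) x a∉ with x ≟ a
  ... | yes refl = sym (cycleGo-∷ʳ-last b b bs x a∉)
  ... | no x≢a = sym (cycleGo-∷ʳ b b bs a x x≢a)

  unique-∷ʳ : {xs : List (Fin N)} {a : Fin N} → Unique xs → a ∉ xs → Unique (xs ∷ʳ a)
  unique-∷ʳ u a∉ = ++⁺ u ([] ∷ []) (λ { (a∈ , here refl) → a∉ a∈ })

  unique-reverse : {xs : List (Fin N)} → Unique xs → Unique (reverse xs)
  unique-reverse {xs} = Unique-resp-↭ S (↭-sym S (↭-reverse S xs))
    where S = setoid (Fin N)

  cycle-++-comm : (xs ys : List (Fin N)) (x : Fin N) →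
                  Unique (xs ++ ys) → cycle (xs ++ ys) x ≡ cycle (ys ++ xs) x
  cycle-++-comm [] ys x u = cong (λ l → cycle l x) (sym (++-identityʳ ys))
  cycle-++-comm (a ∷ xs) ys x u@(_ ∷ u′) = begin
      cycle (a ∷ xs ++ ys) x        ≡⟨ cycle-∷≡∷ʳ a (xs ++ ys) x a∉ ⟩
      cycle ((xs ++ ys) ∷ʳ a) x     ≡⟨ cong (λ l → cycle l x) (++-assoc xs ys [ a ]) ⟩
      cycle (xs ++ (ys ∷ʳ a)) x     ≡⟨ cycle-++-comm xs (ys ∷ʳ a) x u″ ⟩
      cycle ((ys ∷ʳ a) ++ xs) x     ≡⟨ cong (λ l → cycle l x) (++-assoc ys [ a ] xs) ⟩
      cycle (ys ++ a ∷ xs) x        ∎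
    where
      open ≡-Reasoning
      a∉ : a ∉ xs ++ ys
      a∉ = Unique[x∷xs]⇒x∉xs u
      u″ : Unique (xs ++ (ys ∷ʳ a))
      u″ = subst Unique (++-assoc xs ys [ a ]) (unique-∷ʳ u′ a∉)

  cycle-reverse-resp-≈∘ : {xs ys : List (Fin N)} → Unique xs → xs ≈∘ ys →
                          (x : Fin N) → cycle (reverse ys) x ≡ cycle (reverse xs) x
  cycle-reverse-resp-≈∘ {xs} u (k , refl) x = begin
      cycle (reverse (D ++ T)) x      ≡⟨ cong (λ l → cycle l x) (reverse-++ D T) ⟩
      cycle (reverse T ++ reverse D) x ≡⟨ cycle-++-comm (reverse D) (reverse T) x u′ ⟨
      cycle (reverse D ++ reverse T) x ≡⟨ cong (λ l → cycle l x) (reverse-++ T D) ⟨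
      cycle (reverse (T ++ D)) x      ≡⟨ cong (λ l → cycle (reverse l) x) (take++drop≡id k xs) ⟩
      cycle (reverse xs) x            ∎
    where
      open ≡-Reasoning
      T = take k xs
      D = drop k xs
      u′ : Unique (reverse D ++ reverse T)
      u′ = subst Unique (reverse-++ T D)
             (unique-reverse (subst Unique (sym (take++drop≡id k xs)) u))

  cycleGo-map : (f : Fin N → Fin N) → (∀ {a b} → f a ≡ f b → a ≡ b) →
                (a y : Fin N) (r : List (Fin N)) (x : Fin N) →
                cycleGo (f a) (f y) (map f r) (f x) ≡ f (cycleGo a y r x)
  cycleGo-map f inj a y [] x with x ≟ y | f x ≟ f y
  ... | yes _   | yes _    = refl
  ... | yes x≡y | no fx≢fy = ⊥-elim (fx≢fy (cong f x≡y))
  ... | no x≢y  | yes fx≡fy = ⊥-elim (x≢y (inj fx≡fy))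
  ... | no _    | no _     = refl
  cycleGo-map f inj a y (z ∷ r) x with x ≟ y | f x ≟ f y
  ... | yes _   | yes _    = refl
  ... | yes x≡y | no fx≢fy = ⊥-elim (fx≢fy (cong f x≡y))
  ... | no x≢y  | yes fx≡fy = ⊥-elim (x≢y (inj fx≡fy))
  ... | no _    | no _     = cycleGo-map f inj a z r x

  cycle-map : (f : Fin N → Fin N) → (∀ {a b} → f a ≡ f b → a ≡ b) →
              (xs : List (Fin N)) (x : Fin N) → cycle (map f xs) (f x) ≡ f (cycle xs x)
  cycle-map f inj [] x = refl
  cycle-map f inj (a ∷ xs) x = cycleGo-map f inj a a xs x

module _ {n : ℕ} (π : Permutation′ n) where

  zero∉entries : zero ∉ entries π
  zero∉entries z∈ with ∈-map⁻ (λ i → suc (π ⟨$⟩ʳ i)) z∈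
  ... | _ , _ , ()

  unique-entries : Unique (entries π)
  unique-entries = subst Unique (sym (map-∘ (allFin n)))
    (map⁺ suc-injective (map⁺ (Injection.injective (↔⇒↣ π)) (allFin⁺ n)))

  unique-circ : Unique (circ π)
  unique-circ = ¬Any⇒All¬ (entries π) zero∉entries ∷ unique-entries

  bar-cycle : (x : Fin (suc n)) → bar π x ≡ γ n (cycle (reverse (circ π)) x)
  bar-cycle x = cong (γ n) (begin
      cycle (zero ∷ reverse (entries π)) x     ≡⟨ cycle-∷≡∷ʳ zero _ x (zero∉entries ∘ reverse⁻) ⟩
      cycle (reverse (entries π) ∷ʳ zero) x    ≡⟨ cong (λ l → cycle l x) (unfold-reverse zero (entries π)) ⟨
      cycle (reverse (circ π)) x               ∎)
    where open ≡-Reasoning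

iter-commute : {A : Set} (f : A → A) (m : ℕ) (x : A) → f (iter m f x) ≡ iter m f (f x)
iter-commute f zero x = refl
iter-commute f (suc m) x = cong f (iter-commute f m x)

iter-inverse : {A : Set} (f g : A → A) → (∀ z → g (f z) ≡ z) →
               (m : ℕ) (z : A) → iter m g (iter m f z) ≡ z
iter-inverse f g g∘f≡id zero z = refl
iter-inverse f g g∘f≡id (suc m) z = begin
    g (iter m g (f (iter m f z)))  ≡⟨ cong (g ∘ iter m g) (iter-commute f m z) ⟩
    g (iter m g (iter m f (f z)))  ≡⟨ cong g (iter-inverse f g g∘f≡id m (f z)) ⟩
    g (f z)                        ≡⟨ g∘f≡id z ⟩
    z                              ∎
  where open ≡-Reasoning

module _ (n : ℕ) where

  toℕ-shift : (m : ℕ) (x : Fin (suc n)) → toℕ (shift n m x) ≡ (toℕ x + m) % suc n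
  toℕ-shift m x = toℕ-fromℕ< _

  [m%n+k]%n≡[m+k]%n : (a k : ℕ) → (a % suc n + k) % suc n ≡ (a + k) % suc n
  [m%n+k]%n≡[m+k]%n a k = begin
      (a % suc n + k) % suc n                ≡⟨ %-distribˡ-+ (a % suc n) k (suc n) ⟩
      (a % suc n % suc n + k % suc n) % suc n ≡⟨ cong (λ v → (v + k % suc n) % suc n) (m%n%n≡m%n a (suc n)) ⟩
      (a % suc n + k % suc n) % suc n        ≡⟨ %-distribˡ-+ a k (suc n) ⟨
      (a + k) % suc n                        ∎
    where open ≡-Reasoning

  shift-shift : (a b : ℕ) (x : Fin (suc n)) → shift n a (shift n b x) ≡ shift n (b + a) x
  shift-shift a b x = toℕ-injective (begin
      toℕ (shift n a (shift n b x))     ≡⟨ toℕ-shift a (shift n b x) ⟩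
      (toℕ (shift n b x) + a) % suc n   ≡⟨ cong (λ v → (v + a) % suc n) (toℕ-shift b x) ⟩
      ((toℕ x + b) % suc n + a) % suc n ≡⟨ [m%n+k]%n≡[m+k]%n (toℕ x + b) a ⟩
      (toℕ x + b + a) % suc n           ≡⟨ cong (_% suc n) (+-assoc (toℕ x) b a) ⟩
      (toℕ x + (b + a)) % suc n         ≡⟨ toℕ-shift (b + a) x ⟨
      toℕ (shift n (b + a) x)           ∎)
    where open ≡-Reasoning

  shift-zero : (x : Fin (suc n)) → shift n 0 x ≡ x
  shift-zero x = toℕ-injective (trans (toℕ-shift 0 x)
    (trans (cong (_% suc n) (+-comm (toℕ x) 0)) (m<n⇒m%n≡m (toℕ<n x))))

  shift-suc-n : (x : Fin (suc n)) → shift n (suc n) x ≡ x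
  shift-suc-n x = toℕ-injective (trans (toℕ-shift (suc n) x)
    (trans ([m+n]%n≡m%n (toℕ x) (suc n)) (m<n⇒m%n≡m (toℕ<n x))))

  iter-γ : (m : ℕ) (x : Fin (suc n)) → iter m (γ n) x ≡ shift n m x
  iter-γ zero x = sym (shift-zero x)
  iter-γ (suc m) x = trans (cong (γ n) (iter-γ m x))
    (trans (shift-shift 1 m x) (cong (λ k → shift n k x) (+-comm m 1)))

  γ-γ⁻¹ : (x : Fin (suc n)) → γ n (γ⁻¹ n x) ≡ x
  γ-γ⁻¹ x = trans (shift-shift 1 n x) (trans (cong (λ k → shift n k x) (+-comm n 1)) (shift-suc-n x))

  γ⁻¹-γ : (x : Fin (suc n)) → γ⁻¹ n (γ n x) ≡ x
  γ⁻¹-γ x = trans (shift-shift n 1 x) (shift-suc-n x)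

  cycle-map-shift : (m : ℕ) (xs : List (Fin (suc n))) (x : Fin (suc n)) →
                    cycle (map (shift n m) xs) x ≡ iter m (γ n) (cycle xs (iter m (γ⁻¹ n) x))
  cycle-map-shift m xs x = begin
      cycle (map s xs) x      ≡⟨ cong (cycle (map s xs)) s-y≡x ⟨
      cycle (map s xs) (s y)  ≡⟨ cycle-map s s-injective xs y ⟩
      s (cycle xs y)          ≡⟨ iter-γ m (cycle xs y) ⟨
      iter m (γ n) (cycle xs y) ∎
    where
      open ≡-Reasoning
      s = shift n m
      y = iter m (γ⁻¹ n) x
      s-y≡x : s y ≡ x
      s-y≡x = trans (sym (iter-γ m y)) (iter-inverse (γ⁻¹ n) (γ n) γ-γ⁻¹ m x)
      s-injective : ∀ {a b} → s a ≡ s b → a ≡ b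
      s-injective {a} {b} sa≡sb = begin
          a                                 ≡⟨ iter-inverse (γ n) (γ⁻¹ n) γ⁻¹-γ m a ⟨
          iter m (γ⁻¹ n) (iter m (γ n) a)   ≡⟨ cong (iter m (γ⁻¹ n)) (trans (iter-γ m a) (trans sa≡sb (sym (iter-γ m b)))) ⟩
          iter m (γ⁻¹ n) (iter m (γ n) b)   ≡⟨ iter-inverse (γ n) (γ⁻¹ n) γ⁻¹-γ m b ⟩
          b                                 ∎

lemma11 : (n m : ℕ) (π σ : Permutation′ n) → m ≤ n →
    circ σ ≈∘ shiftCirc m π →
    (x : Fin (suc n)) → bar σ x ≡ iter m (γ n) (bar π (iter m (γ⁻¹ n) x))
lemma11 n m π σ _ σ°≈m+π° x = begin
    bar σ x                                            ≡⟨ bar-cycle σ x ⟩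
    γ n (cycle (reverse (circ σ)) x)                   ≡⟨ cong (γ n) (cycle-reverse-resp-≈∘ (unique-circ σ) σ°≈m+π° x) ⟨
    γ n (cycle (reverse (map (shift n m) (circ π))) x) ≡⟨ cong (λ l → γ n (cycle l x)) (reverse-map (shift n m) (circ π)) ⟨
    γ n (cycle (map (shift n m) (reverse (circ π))) x) ≡⟨ cong (γ n) (cycle-map-shift n m (reverse (circ π)) x) ⟩
    γ n (iter m (γ n) (cycle (reverse (circ π)) y))    ≡⟨ iter-commute (γ n) m _ ⟩
    iter m (γ n) (γ n (cycle (reverse (circ π)) y))    ≡⟨ cong (iter m (γ n)) (bar-cycle π y) ⟨
    iter m (γ n) (bar π y)                             ∎
  where
    open ≡-Reasoning
    y = iter m (γ⁻¹ n) x
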